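{- Let $n\ge 1$ and let $\mathcal K_n$ be the simplicial complex on the vertex set $\{(i,\overline j): 0\le i\le j\le n\}$ whose faces are the $([n],[\overline n])$-forests (regarded as sets of arcs). Then $\mathcal K_n$ is isomorphic to the join of an $(n+1)$-dimensional simplex with the boundary complex of a simplicial $(n-1)$-dimensional associahedron, i.e. with the simplicial complex whose faces are the sets of pairwise non-crossing inner diagonals of a convex $(n+2)$-gon.
   Context: $[n]=\{0,1,\dots,n\}$, $[\overline n]=\{\overline 0,\dots,\overline n\}$. An $([n],[\overline n])$-forest is a set of arcs $(i,\overline j)$, $i,j\in[n]$, such that every arc satisfies $i\le j$ and no two arcs $(i,\overline j),(i',\overline{j'})$ satisfy $i<i'\le j<j'$. The join of simplicial complexes $\mathcal K,\mathcal K'$ on disjoint ground sets is $\{F\cup F': F\in\mathcal K, F'\in\mathcal K'\}$. -}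

module Defs where

open import Data.Nat using (ℕ; zero; suc; _≤_; _<_)
open import Data.Bool using (Bool; true)
open import Data.Fin using (Fin)
open import Data.Sum using (_⊎_; inj₁; inj₂)
open import Data.Product using (_×_)
open import Data.Unit using (⊤)
open import Relation.Nullary using (¬_)
open import Relation.Binary.PropositionalEquality using (_≡_)
open import Function using (_∘_)
open import Function.Bundles using (_↔_; _⇔_; Inverse)

record SimplicialComplex : Set₁ where
  field
    Vertex : Set
    IsFace : (Vertex → Bool) → Set
open SimplicialComplex public

-- Isomorphism: a bijection of vertex sets mapping faces exactly onto faces.
-- The image of S ⊆ V under σ is  S ∘ σ⁻¹.
_≅_ : SimplicialComplex → SimplicialComplex → Set
K ≅ L = Data.Product.Σ (Vertex K ↔ Vertex L) λ σ →
          (S : Vertex K → Bool) → IsFace K S ⇔ IsFace L (S ∘ Inverse.from σ)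

-- Join on the disjoint union of the ground sets: faces are F ∪ F'
-- with F ∈ K, F' ∈ L, i.e. S is a face iff S ∩ V(K) ∈ K and S ∩ V(L) ∈ L.
Join : SimplicialComplex → SimplicialComplex → SimplicialComplex
Join K L = record
  { Vertex = Vertex K ⊎ Vertex L
  ; IsFace = λ S → IsFace K (S ∘ inj₁) × IsFace L (S ∘ inj₂) }

-- The full simplex on vertex type V (every subset is a face).
-- The (n+1)-dimensional simplex is  Simplex (Fin (n + 2)).
Simplex : Set → SimplicialComplex
Simplex V = record { Vertex = V ; IsFace = λ _ → ⊤ }

-- An arc (i, j̄) with 0 ≤ i ≤ j ≤ n  (proofs irrelevant: an arc is its endpoints).
record Arc (n : ℕ) : Set where
  constructor arc
  field
    i j : ℕ
    .i≤j : i ≤ j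
    .j≤n : j ≤ n
open Arc public

-- (i, j̄) and (i', j̄') violate the forest condition:  i < i' ≤ j < j'.
ArcCross : ∀ {n} → Arc n → Arc n → Set
ArcCross x y = (i x < i y) × (i y ≤ j x) × (j x < j y)

IsForest : ∀ {n} → (Arc n → Bool) → Set
IsForest S = ∀ x y → S x ≡ true → S y ≡ true → ¬ ArcCross x y

K : ℕ → SimplicialComplex
K n = record { Vertex = Arc n ; IsFace = IsForest }

-- Boundary complex of the simplicial associahedron: non-crossing sets of
-- inner diagonals of a convex (n+2)-gon with vertices 0,1,…,n+1 in
-- cyclic order.

record Diagonal (n : ℕ) : Set where
  constructor diag
  field
    a b : ℕ
    .a+2≤b : suc (suc a) ≤ b
    .b≤n+1 : b ≤ suc n
    .notSide : ¬ (a ≡ 0 × b ≡ suc n)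
open Diagonal public

-- Diagonals {a,b},{c,d} cross (in their interiors) iff a < c < b < d
-- (up to swapping the two diagonals).
DiagCross : ∀ {n} → Diagonal n → Diagonal n → Set
DiagCross x y = (a x < a y) × (a y < b x) × (b x < b y)

IsNonCrossing : ∀ {n} → (Diagonal n → Bool) → Set
IsNonCrossing S = ∀ x y → S x ≡ true → S y ≡ true → ¬ DiagCross x y

Assoc : ℕ → SimplicialComplex
Assoc n = record { Vertex = Diagonal n ; IsFace = IsNonCrossing }

-- An arc (i, j̄) with i < j other than the root arc (0, n̄) is the inner
-- diagonal {i, j + 1} of the (n+2)-gon, and under this shift the forest
-- condition i < i' ≤ j < j' becomes the crossing condition
-- i < i' < j + 1 < j' + 1.  The remaining n + 2 arcs, the loops (i, ī) and
-- (0, n̄), cross nothing and span the simplex.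
module Submission where

open import Defs
open import Data.Nat using (ℕ; zero; suc; pred; _≤_; _<_; _+_; z≤n; s≤s; s≤s⁻¹; _≟_; _≤?_)
open import Data.Nat.Properties
open import Data.Fin using (Fin; toℕ; fromℕ<)
open import Data.Fin.Properties using (toℕ-injective; toℕ<n; fromℕ<-toℕ; toℕ-fromℕ<)
open import Data.Sum using (_⊎_; inj₁; inj₂; [_,_])
open import Data.Product using (_×_; _,_)
open import Data.Unit using (tt)
open import Data.Bool using (Bool)
open import Data.Empty using (⊥-elim)
import Data.Empty.Irrelevant as Irrelevant
open import Relation.Nullary using (¬_; yes; no)
open import Relation.Nullary.Decidable using (_×-dec_; recompute)
open import Relation.Binary.PropositionalEquality using (_≡_; refl; sym; trans; cong; subst)
open import Function using (_∘_)
open import Function.Bundles using (_↔_; mk↔ₛ′; mk⇔)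

innerDiagonal : ∀ {n} i j → .(i < j) → .(j ≤ n) → .(¬ (i ≡ 0 × j ≡ n)) → Diagonal n
innerDiagonal i j i<j j≤n notRoot =
  diag i (suc j) (s≤s i<j) (s≤s j≤n) (λ (i≡0 , 1+j≡1+n) → notRoot (i≡0 , suc-injective 1+j≡1+n))

diagonalArc : ∀ {n} → Diagonal n → Arc n
diagonalArc (diag a b a+2≤b b≤n+1 _) =
  arc a (pred b) (≤-trans (n≤1+n a) (pred-mono-≤ a+2≤b)) (pred-mono-≤ b≤n+1)

diagCross⇒arcCross : ∀ {n} (d e : Diagonal n) →
                     DiagCross d e → ArcCross (diagonalArc d) (diagonalArc e)
diagCross⇒arcCross (diag _ (suc _) _ _ _) (diag _ (suc _) _ _ _) (a<a' , a'<1+b , 1+b<1+b') =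
  a<a' , s≤s⁻¹ a'<1+b , s≤s⁻¹ 1+b<1+b'
diagCross⇒arcCross (diag _ zero _ _ _) _ (_ , () , _)
diagCross⇒arcCross (diag _ (suc _) _ _ _) (diag _ zero _ _ _) (_ , _ , ())

forest⇒nonCrossing : ∀ {n} (S : Arc n → Bool) → IsForest S → IsNonCrossing (S ∘ diagonalArc)
forest⇒nonCrossing S forest d e Sd Se = forest _ _ Sd Se ∘ diagCross⇒arcCross d e

-- Two crossing arcs are inner: the left one is not the root since j < j' ≤ n,
-- the right one since 0 ≤ i < i'.  This makes the correspondence exact.
nonCrossing⇒forest : ∀ {n} (S : Arc n → Bool) → IsNonCrossing (S ∘ diagonalArc) → IsForest S
nonCrossing⇒forest S nonCrossing (arc i j _ j≤n) (arc i' j' _ j'≤n) Sx Sy (i<i' , i'≤j , j<j') =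
  nonCrossing
    (innerDiagonal i j (<-≤-trans i<i' i'≤j) j≤n
       (λ (_ , j≡n) → <-irrefl j≡n (<-≤-trans j<j' j'≤n)))
    (innerDiagonal i' j' (≤-<-trans i'≤j j<j') j'≤n
       (λ (i'≡0 , _) → n≮0 (subst (i <_) i'≡0 i<i')))
    Sx Sy (i<i' , s≤s i'≤j , s≤s j<j')

module _ {n : ℕ} where

  loopIndex : ∀ {i} → .(i ≤ n) → Fin (n + 2)
  loopIndex i≤n = fromℕ< (≤-<-trans i≤n (m<m+n n (s≤s z≤n)))

  rootIndex : Fin (n + 2)
  rootIndex = fromℕ< (≤-reflexive (+-comm 2 n))

  -- The index n + 1 stands for the root arc (0, n̄); every other index k for the loop (k, k̄).
  indexArc : Fin (n + 2) → Arc n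
  indexArc k with toℕ k ≤? n
  ... | yes k≤n = arc (toℕ k) (toℕ k) ≤-refl k≤n
  ... | no _    = arc 0 n z≤n ≤-refl

  classify : Arc n → Fin (n + 2) ⊎ Diagonal n
  classify (arc i j i≤j j≤n) with i ≟ j
  ... | yes _ = inj₁ (loopIndex (≤-trans i≤j j≤n))
  ... | no i≢j with (i ≟ 0) ×-dec (j ≟ n)
  ...   | yes _     = inj₁ rootIndex
  ...   | no notRoot = inj₂ (innerDiagonal i j (≤∧≢⇒< i≤j i≢j) j≤n notRoot)

  unclassify : Fin (n + 2) ⊎ Diagonal n → Arc n
  unclassify = [ indexArc , diagonalArc ]

  classify-loop : ∀ i .i≤i .(i≤n : i ≤ n) → classify (arc i i i≤i i≤n) ≡ inj₁ (loopIndex i≤n)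
  classify-loop i _ _ with i ≟ i
  ... | yes _ = refl
  ... | no i≢i = ⊥-elim (i≢i refl)

  classify-root : 1 ≤ n → ∀ .0≤n .n≤n → classify (arc 0 n 0≤n n≤n) ≡ inj₁ rootIndex
  classify-root 1≤n _ _ with 0 ≟ n
  ... | yes 0≡n = ⊥-elim (<⇒≢ 1≤n 0≡n)
  ... | no _ with (0 ≟ 0) ×-dec (n ≟ n)
  ...   | yes _ = refl
  ...   | no notRoot = ⊥-elim (notRoot (refl , refl))

  classify-diagonalArc : ∀ d → classify (diagonalArc d) ≡ inj₂ d
  classify-diagonalArc (diag a zero a+2≤b _ _) = Irrelevant.⊥-elim (n≮0 a+2≤b)
  classify-diagonalArc (diag a (suc b) a+2≤b _ notSide) with a ≟ b
  ... | yes a≡b = Irrelevant.⊥-elim (<⇒≢ (s≤s⁻¹ a+2≤b) a≡b)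
  ... | no _ with (a ≟ 0) ×-dec (b ≟ n)
  ...   | yes (a≡0 , b≡n) = Irrelevant.⊥-elim (notSide (a≡0 , cong suc b≡n))
  ...   | no _ = refl

  classify-unclassify : 1 ≤ n → ∀ v → classify (unclassify v) ≡ v
  classify-unclassify 1≤n (inj₁ k) with toℕ k ≤? n
  ... | yes k≤n = trans (classify-loop (toℕ k) ≤-refl k≤n) (cong inj₁ (fromℕ<-toℕ k _))
  ... | no k≰n  = trans (classify-root 1≤n z≤n ≤-refl) (cong inj₁ (toℕ-injective (trans (toℕ-fromℕ< _) (sym k≡1+n))))
    where
    k≡1+n : toℕ k ≡ suc n
    k≡1+n = ≤-antisym (s≤s⁻¹ (subst (toℕ k <_) (+-comm n 2) (toℕ<n k))) (≰⇒> k≰n)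
  classify-unclassify _ (inj₂ d) = classify-diagonalArc d

  indexArc-loop : ∀ {i} (k : Fin (n + 2)) → toℕ k ≡ i → i ≤ n → ∀ .i≤i .i≤n →
                  indexArc k ≡ arc i i i≤i i≤n
  indexArc-loop k k≡i i≤n _ _ with toℕ k ≤? n
  ... | yes _ rewrite k≡i = refl
  ... | no k≰n = ⊥-elim (k≰n (subst (_≤ n) (sym k≡i) i≤n))

  indexArc-root : ∀ (k : Fin (n + 2)) → toℕ k ≡ suc n → ∀ .0≤n .n≤n → indexArc k ≡ arc 0 n 0≤n n≤n
  indexArc-root k k≡1+n _ _ with toℕ k ≤? n
  ... | yes k≤n = ⊥-elim (<-irrefl refl (subst (_≤ n) k≡1+n k≤n))
  ... | no _ = refl

  unclassify-classify : ∀ x → unclassify (classify x) ≡ x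
  unclassify-classify (arc i j i≤j j≤n) with i ≟ j
  ... | yes refl = indexArc-loop _ (toℕ-fromℕ< _) (recompute (i ≤? n) (≤-trans i≤j j≤n)) i≤j j≤n
  ... | no _ with (i ≟ 0) ×-dec (j ≟ n)
  ...   | yes (refl , refl) = indexArc-root _ (toℕ-fromℕ< _) i≤j j≤n
  ...   | no _ = refl

  arcs↔indices⊎diagonals : 1 ≤ n → Arc n ↔ (Fin (n + 2) ⊎ Diagonal n)
  arcs↔indices⊎diagonals 1≤n = mk↔ₛ′ classify unclassify (classify-unclassify 1≤n) unclassify-classify

proposition4p2 : (n : ℕ) → 1 ≤ n → K n ≅ Join (Simplex (Fin (n + 2))) (Assoc n)
proposition4p2 n 1≤n =
  arcs↔indices⊎diagonals 1≤n ,
  λ S → mk⇔ (λ forest → tt , forest⇒nonCrossing S forest)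
            (λ (_ , nonCrossing) → nonCrossing⇒forest S nonCrossing)
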